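{- Let $\mathcal O$ be the ring of integers of a finite extension of $\mathbb Q_p$, $g\ge0$, $r\ge0$. Then (1) $\mathrm{Fil}^r(V_g(\mathcal O))$ is stable under the action of $S_0(p)$; (2) if $P\in\mathrm{Fil}^r(V_g(\mathcal O))$, then $P\,\big|\begin{pmatrix}1&a\\0&p\end{pmatrix}\in p^rV_g(\mathcal O)$ for every integer $a$.
   Context: $p$ odd prime. $V_g(\mathcal O)$: homogeneous degree-$g$ polynomials in $X,Y$ over $\mathcal O$ with right action $(P|\gamma)(X,Y)=P(dX-cY,-bX+aY)$ for $\gamma=\begin{pmatrix}a&b\\c&d\end{pmatrix}$. $S_0(p)=\{\begin{pmatrix}a&b\\c&d\end{pmatrix}\in M_2(\mathbb Z):ad-bc\ne0,\ p\mid c,\ p\nmid a\}$. $\mathrm{Fil}^r(V_g(\mathcal O))=\{\sum_{j=0}^gb_jX^jY^{g-j}\in V_g(\mathcal O):p^{r-j}\mid b_j\text{ for }0\le j\le r-1\}$. -}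

module Defs where

open import Level using (Level)
open import Algebra.Bundles using (CommutativeRing)
open import Data.Nat as ℕ using (ℕ; zero; suc; _∸_; _<_)
open import Data.Integer as ℤ using (ℤ; +_; -[1+_])
open import Data.Integer.Divisibility as ℤDiv using ()
open import Data.Fin using (Fin; toℕ)
open import Data.List using (List; []; _∷_; map; foldr; allFin)
open import Data.Product using (Σ; _×_)
open import Relation.Nullary using (¬_)
open import Relation.Binary.PropositionalEquality using (_≡_)

record M2 : Set where
  constructor mat
  field
    a b c d : ℤ

record InS₀ (p : ℕ) (γ : M2) : Set where
  open M2 γ
  field
    det≢0 : ¬ (a ℤ.* d ℤ.- b ℤ.* c ≡ + 0)
    p∣c   : (+ p) ℤDiv.∣ c
    p∤a   : ¬ ((+ p) ℤDiv.∣ a)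

module _ {c ℓ : Level} (R : CommutativeRing c ℓ) where
  open CommutativeRing R

  ιℕ : ℕ → Carrier
  ιℕ zero    = 0#
  ιℕ (suc n) = 1# + ιℕ n

  ι : ℤ → Carrier
  ι (+ n)     = ιℕ n
  ι -[1+ n ]  = - ιℕ (suc n)

  pow : Carrier → ℕ → Carrier
  pow x zero    = 1#
  pow x (suc n) = x * pow x n

  DivPow : ℕ → ℕ → Carrier → Set (c Level.⊔ ℓ)
  DivPow p k x = Σ Carrier (λ y → x ≈ pow (ιℕ p) k * y)

  -- Elements of V_g(R): coefficient functions, P j = coefficient of X^j Y^(g-j)
  V : ℕ → Set c
  V g = Fin (suc g) → Carrier

  -- auxiliary one-variable polynomials (dehomogenised at Y = 1),
  -- ascending coefficient lists in X
  addP : List Carrier → List Carrier → List Carrier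
  addP []       q        = q
  addP (x ∷ p)  []       = x ∷ p
  addP (x ∷ p)  (y ∷ q)  = (x + y) ∷ addP p q

  scaleP : Carrier → List Carrier → List Carrier
  scaleP s = map (s *_)

  mulP : List Carrier → List Carrier → List Carrier
  mulP []      q = []
  mulP (x ∷ p) q = addP (scaleP x q) (0# ∷ mulP p q)

  powP : List Carrier → ℕ → List Carrier
  powP q zero    = 1# ∷ []
  powP q (suc n) = mulP q (powP q n)

  coeffL : List Carrier → ℕ → Carrier
  coeffL []       _       = 0#
  coeffL (x ∷ _)  zero    = x
  coeffL (_ ∷ q)  (suc n) = coeffL q n

  -- right action: (P|γ)(X,Y) = P(dX - cY, -bX + aY)
  act : (g : ℕ) → V g → M2 → V g
  act g P (mat a b c' d) j = coeffL total (toℕ j)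
    where
      L₁ L₂ : List Carrier
      L₁ = (- ι c') ∷ ι d ∷ []      -- dX - cY  at Y = 1
      L₂ = ι a ∷ (- ι b) ∷ []       -- -bX + aY at Y = 1
      term : Fin (suc g) → List Carrier
      term i = scaleP (P i) (mulP (powP L₁ (toℕ i)) (powP L₂ (g ∸ toℕ i)))
      total : List Carrier
      total = foldr addP [] (map term (allFin (suc g)))

  Fil : (p g r : ℕ) → V g → Set (c Level.⊔ ℓ)
  Fil p g r P = (j : Fin (suc g)) → toℕ j < r → DivPow p (r ∸ toℕ j) (P j)

  InPowV : (p g r : ℕ) → V g → Set (c Level.⊔ ℓ)
  InPowV p g r P = (j : Fin (suc g)) → DivPow p r (P j)

module Submission where

-- Dehomogenising at Y = 1, P | (a b ; c d) is the polynomial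
--   Σ_i  b_i · (dX − c)^i · (−bX + a)^(g−i),
-- whose n-th coefficient is the coefficient of X^n Y^(g−n).  Writing π for
-- the image of p in R, call a one-variable polynomial f-bounded when π^(f n)
-- divides its n-th coefficient.  Bounds survive sums and scalar multiples,
-- and survive products whenever the bound functions are subadditive along
-- the convolution n + m; iterating gives bounds for powers.
--  (1) If p ∣ c then dX − c is bounded by n ↦ 1 ∸ n, so its i-th power is
--      bounded by n ↦ i ∸ n; as p^(r ∸ i) ∣ b_i, the i-th term is bounded
--      by (r ∸ i) + (i ∸ n) ≥ r ∸ n.

open import Defs
open import Level using (Level; _⊔_)
open import Algebra.Bundles using (CommutativeRing)
open import Data.Nat using (ℕ)
open import Data.Nat.Primality using (Prime)
open import Data.Integer using (ℤ; +_)
open import Data.Product using (_×_)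
open import Relation.Binary.PropositionalEquality using (_≢_)

open import Data.Nat as ℕ using (zero; suc; _∸_; _≤_; _<?_; z≤n)
import Data.Nat.Properties as ℕ
open import Data.Nat.Divisibility using (divides; _∣_; ∣-refl; _∣0)
open import Data.Integer using (-[1+_])
import Data.Integer.Divisibility as ℤ
open import Data.Fin using (Fin; toℕ)
open import Data.List using (List; []; _∷_; foldr; map; allFin)
open import Data.Product using (_,_)
open import Relation.Nullary using (yes; no)
open import Relation.Binary.PropositionalEquality as ≡ using (_≡_)
import Algebra.Properties.Ring as RingProperties
import Algebra.Properties.Semiring.Mult as SemiringMult
import Algebra.Properties.CommutativeSemigroup as CommutativeSemigroupProperties

≤-∸-+ : ∀ r i → r ≤ (r ∸ i) ℕ.+ i
≤-∸-+ r i = ℕ.≤-trans (ℕ.m≤n+m∸n r i) (ℕ.≤-reflexive (ℕ.+-comm i (r ∸ i)))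

-- Triangle inequality for the "distance" r ∸ n through a midpoint i; it
-- combines the filtration exponent r ∸ i with the bound i ∸ n of a term.
∸-triangle : ∀ r i n → r ∸ n ≤ (r ∸ i) ℕ.+ (i ∸ n)
∸-triangle r       i       zero    = ≤-∸-+ r i
∸-triangle zero    i       (suc n) = z≤n
∸-triangle (suc r) zero    (suc n) =
  ℕ.≤-trans (ℕ.m∸n≤m r n) (ℕ.≤-trans (ℕ.n≤1+n r) (ℕ.m≤m+n (suc r) 0))
∸-triangle (suc r) (suc i) (suc n) = ∸-triangle r i n

-- Subadditivity making n ↦ i ∸ n a bound for the i-th power of a
-- polynomial bounded by n ↦ 1 ∸ n.
∸-power-step : ∀ i n m → suc i ∸ (n ℕ.+ m) ≤ (1 ∸ n) ℕ.+ (i ∸ m)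
∸-power-step i zero    m = ℕ.≤-trans (∸-triangle (suc i) i m)
  (ℕ.≤-reflexive (≡.cong (ℕ._+ (i ∸ m)) (ℕ.m+n∸n≡m 1 i)))
∸-power-step i (suc n) m =
  ℕ.≤-trans (ℕ.∸-monoʳ-≤ i (ℕ.m≤n+m m n)) (ℕ.m≤n+m (i ∸ m) (0 ∸ n))

module _ {c ℓ : Level} (R : CommutativeRing c ℓ) (p : ℕ) where
  open CommutativeRing R
  open RingProperties ring using (-‿distribʳ-*)
  open SemiringMult semiring using (×1-homo-*) renaming (_×_ to _·_)
  open CommutativeSemigroupProperties *-commutativeSemigroup using (interchange)
  open import Relation.Binary.Reasoning.Setoid setoid

  π : Carrier
  π = ιℕ R p

  powπ : ℕ → Carrier
  powπ = pow R π

  -- π^k ∣ x, as a record so that k and x can be inferred from the type.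
  record π^_∣_ (k : ℕ) (x : Carrier) : Set (c ⊔ ℓ) where
    constructor divπ
    field witness : DivPow R p k x
  open π^_∣_

  powπ-+ : ∀ k m → powπ (k ℕ.+ m) ≈ powπ k * powπ m
  powπ-+ zero    m = sym (*-identityˡ _)
  powπ-+ (suc k) m = trans (*-congˡ (powπ-+ k m)) (sym (*-assoc _ _ _))

  π^0∣ : ∀ {x} → π^ 0 ∣ x
  π^0∣ {x} = divπ (x , sym (*-identityˡ x))

  π^∣0 : ∀ {k} → π^ k ∣ 0#
  π^∣0 = divπ (0# , sym (zeroʳ _))

  π^∣-resp : ∀ {k x y} → x ≈ y → π^ k ∣ x → π^ k ∣ y
  π^∣-resp x≈y (divπ (u , x≈πu)) = divπ (u , trans (sym x≈y) x≈πu)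

  π^∣-+ : ∀ {k x y} → π^ k ∣ x → π^ k ∣ y → π^ k ∣ (x + y)
  π^∣-+ (divπ (u , x≈)) (divπ (v , y≈)) =
    divπ (u + v , trans (+-cong x≈ y≈) (sym (distribˡ _ _ _)))

  π^∣-neg : ∀ {k x} → π^ k ∣ x → π^ k ∣ (- x)
  π^∣-neg (divπ (u , x≈)) = divπ (- u , trans (-‿cong x≈) (-‿distribʳ-* _ _))

  π^∣-* : ∀ {k m x y} → π^ k ∣ x → π^ m ∣ y → π^ (k ℕ.+ m) ∣ (x * y)
  π^∣-* {k} {m} {x} {y} (divπ (u , x≈)) (divπ (v , y≈)) = divπ (u * v , (begin
    x * y                       ≈⟨ *-cong x≈ y≈ ⟩
    (powπ k * u) * (powπ m * v) ≈⟨ interchange _ _ _ _ ⟩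
    (powπ k * powπ m) * (u * v) ≈⟨ *-congʳ (sym (powπ-+ k m)) ⟩
    powπ (k ℕ.+ m) * (u * v)    ∎))

  π^∣-weaken : ∀ {m k x} → m ≤ k → π^ k ∣ x → π^ m ∣ x
  π^∣-weaken {m} {k} {x} m≤k (divπ (u , x≈)) = divπ (powπ (k ∸ m) * u , (begin
    x                              ≈⟨ x≈ ⟩
    powπ k * u                     ≡⟨ ≡.cong (λ e → powπ e * u) (≡.sym (ℕ.m+[n∸m]≡n m≤k)) ⟩
    powπ (m ℕ.+ (k ∸ m)) * u         ≈⟨ *-congʳ (powπ-+ m (k ∸ m)) ⟩
    (powπ m * powπ (k ∸ m)) * u    ≈⟨ *-assoc _ _ _ ⟩
    powπ m * (powπ (k ∸ m) * u)    ∎))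

  ιℕ≈·1 : ∀ n → ιℕ R n ≈ n · 1#
  ιℕ≈·1 zero    = refl
  ιℕ≈·1 (suc n) = +-congˡ (ιℕ≈·1 n)

  π∣ιℕ : ∀ {n} → p ∣ n → π^ 1 ∣ ιℕ R n
  π∣ιℕ {n} (divides q ≡.refl) = divπ (ιℕ R q , (begin
    ιℕ R (q ℕ.* p)        ≈⟨ ιℕ≈·1 (q ℕ.* p) ⟩
    (q ℕ.* p) · 1#        ≈⟨ ×1-homo-* q p ⟩
    (q · 1#) * (p · 1#)   ≈⟨ *-cong (sym (ιℕ≈·1 q)) (sym (ιℕ≈·1 p)) ⟩
    ιℕ R q * π            ≈⟨ *-comm _ _ ⟩
    π * ιℕ R q            ≈⟨ *-congʳ (sym (*-identityʳ π)) ⟩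
    (π * 1#) * ιℕ R q     ∎))

  π∣ι : ∀ z → (+ p) ℤ.∣ z → π^ 1 ∣ ι R z
  π∣ι (+ n)      p∣n = π∣ιℕ p∣n
  π∣ι -[1+ n ]   p∣n = π^∣-neg (π∣ιℕ p∣n)

  coeff-addP : ∀ A B n → coeffL R (addP R A B) n ≈ coeffL R A n + coeffL R B n
  coeff-addP []      B       n       = sym (+-identityˡ _)
  coeff-addP (x ∷ A) []      zero    = sym (+-identityʳ _)
  coeff-addP (x ∷ A) []      (suc n) = sym (+-identityʳ _)
  coeff-addP (x ∷ A) (y ∷ B) zero    = refl
  coeff-addP (x ∷ A) (y ∷ B) (suc n) = coeff-addP A B n

  coeff-scaleP : ∀ s A n → coeffL R (scaleP R s A) n ≈ s * coeffL R A n
  coeff-scaleP s []      n       = sym (zeroʳ _)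
  coeff-scaleP s (x ∷ A) zero    = refl
  coeff-scaleP s (x ∷ A) (suc n) = coeff-scaleP s A n

  record Bounded (f : ℕ → ℕ) (L : List Carrier) : Set (c ⊔ ℓ) where
    constructor bounded
    field coeff-dvd : ∀ n → π^ (f n) ∣ coeffL R L n
  open Bounded

  bound-[] : ∀ {f} → Bounded f []
  bound-[] = bounded λ _ → π^∣0

  bound-trivial : ∀ {L} → Bounded (λ _ → 0) L
  bound-trivial = bounded λ _ → π^0∣

  bound-cons : ∀ {f x A} → π^ (f 0) ∣ x → Bounded (λ n → f (suc n)) A → Bounded f (x ∷ A)
  bound-cons hx hA = bounded λ { zero → hx ; (suc n) → coeff-dvd hA n }

  bound-tail : ∀ {f x A} → Bounded f (x ∷ A) → Bounded (λ n → f (suc n)) A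
  bound-tail h = bounded λ n → coeff-dvd h (suc n)

  bound-weaken : ∀ {f g L} → (∀ n → g n ≤ f n) → Bounded f L → Bounded g L
  bound-weaken g≤f h = bounded λ n → π^∣-weaken (g≤f n) (coeff-dvd h n)

  bound-addP : ∀ {f A B} → Bounded f A → Bounded f B → Bounded f (addP R A B)
  bound-addP {A = A} {B} hA hB = bounded λ n →
    π^∣-resp (sym (coeff-addP A B n)) (π^∣-+ (coeff-dvd hA n) (coeff-dvd hB n))

  bound-scaleP : ∀ {f k x A} → π^ k ∣ x → Bounded f A → Bounded (λ n → k ℕ.+ f n) (scaleP R x A)
  bound-scaleP {x = x} {A} hx hA = bounded λ n →
    π^∣-resp (sym (coeff-scaleP x A n)) (π^∣-* hx (coeff-dvd hA n))

  bound-sum : ∀ {f} {I : Set} (t : I → List Carrier) (is : List I) →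
              (∀ i → Bounded f (t i)) → Bounded f (foldr (addP R) [] (map t is))
  bound-sum t []       h = bound-[]
  bound-sum t (i ∷ is) h = bound-addP (h i) (bound-sum t is h)

  -- Products: the n-th coefficient of A·B is a sum of a_i b_m with i + m = n,
  -- so a bound f works as soon as f (i + m) ≤ f₁ i + f₂ m.
  bound-mulP : ∀ {f f₁ f₂ A B} → (∀ n m → f (n ℕ.+ m) ≤ f₁ n ℕ.+ f₂ m) →
               Bounded f₁ A → Bounded f₂ B → Bounded f (mulP R A B)
  bound-mulP {A = []}    sub hA hB = bound-[]
  bound-mulP {A = x ∷ A} sub hA hB =
    bound-addP (bound-weaken (sub 0) (bound-scaleP (coeff-dvd hA 0) hB))
               (bound-cons π^∣0 (bound-mulP (λ n → sub (suc n)) (bound-tail hA) hB))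

  bound-powP : ∀ {f L} (F : ℕ → ℕ → ℕ) → F 0 0 ≡ 0 →
               (∀ i n m → F (suc i) (n ℕ.+ m) ≤ f n ℕ.+ F i m) →
               Bounded f L → ∀ i → Bounded (F i) (powP R L i)
  bound-powP F F00≡0 step hL zero =
    bound-cons (≡.subst (λ k → π^ k ∣ 1#) (≡.sym F00≡0) π^0∣) bound-[]
  bound-powP F F00≡0 step hL (suc i) =
    bound-mulP (step i) hL (bound-powP F F00≡0 step hL i)

  linear₁ : ℤ → ℤ → List Carrier
  linear₁ c' d = (- ι R c') ∷ ι R d ∷ []

  linear₂ : ℤ → ℤ → List Carrier
  linear₂ a b = ι R a ∷ (- ι R b) ∷ []

  actTerm : (g : ℕ) → V R g → M2 → Fin (suc g) → List Carrier
  actTerm g P (mat a b c' d) i =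
    scaleP R (P i) (mulP R (powP R (linear₁ c' d) (toℕ i)) (powP R (linear₂ a b) (g ∸ toℕ i)))

  act-bounded : ∀ {f} g P γ → (∀ i → Bounded f (actTerm g P γ i)) →
                ∀ j → π^ (f (toℕ j)) ∣ act R g P γ j
  act-bounded g P (mat a b c' d) h j =
    coeff-dvd (bound-sum (actTerm g P (mat a b c' d)) (allFin (suc g)) h) (toℕ j)

  fil-dvd : ∀ {g r P} → Fil R p g r P → ∀ i → π^ (r ∸ toℕ i) ∣ P i
  fil-dvd {r = r} {P} fil i with toℕ i <? r
  ... | yes i<r = divπ (fil i i<r)
  ... | no  i≮r = ≡.subst (λ k → π^ k ∣ P i) (≡.sym (ℕ.m≤n⇒m∸n≡0 (ℕ.≮⇒≥ i≮r))) π^0∣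

  term-bounded : ∀ {g r P} a b c' d (F : ℕ → ℕ → ℕ) → Fil R p g r P →
                 (∀ i n m → F i (n ℕ.+ m) ≤ F i n) →
                 (∀ i → Bounded (F i) (powP R (linear₁ c' d) i)) →
                 ∀ i → Bounded (λ n → (r ∸ toℕ i) ℕ.+ F (toℕ i) n) (actTerm g P (mat a b c' d) i)
  term-bounded a b c' d F fil antitone powers i =
    bound-scaleP (fil-dvd fil i)
      (bound-mulP (λ n m → ℕ.≤-trans (antitone (toℕ i) n m) (ℕ.m≤m+n _ 0))
                  (powers (toℕ i)) bound-trivial)

  linear₁-bounded : ∀ c' d → (+ p) ℤ.∣ c' → Bounded (1 ∸_) (linear₁ c' d)
  linear₁-bounded c' d p∣c = bound-cons (π^∣-neg (π∣ι c' p∣c)) (bound-cons π^0∣ bound-[])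

  linear₁-divisible : ∀ c' d → (+ p) ℤ.∣ c' → (+ p) ℤ.∣ d → Bounded (λ _ → 1) (linear₁ c' d)
  linear₁-divisible c' d p∣c p∣d =
    bound-cons (π^∣-neg (π∣ι c' p∣c)) (bound-cons (π∣ι d p∣d) bound-[])

  fil-stable : (g r : ℕ) (P : V R g) (γ : M2) → InS₀ p γ → Fil R p g r P →
               Fil R p g r (act R g P γ)
  fil-stable g r P (mat a b c' d) γ∈S₀ fil j _ =
    witness (act-bounded g P (mat a b c' d) term-bound j)
    where
      powers : ∀ i → Bounded (i ∸_) (powP R (linear₁ c' d) i)
      powers = bound-powP _∸_ ≡.refl ∸-power-step (linear₁-bounded c' d (InS₀.p∣c γ∈S₀))
      term-bound : ∀ i → Bounded (r ∸_) (actTerm g P (mat a b c' d) i)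
      term-bound i = bound-weaken (∸-triangle r (toℕ i))
        (term-bounded a b c' d _∸_ fil (λ i n m → ℕ.∸-monoʳ-≤ i (ℕ.m≤m+n n m)) powers i)

  fil-to-pʳV : (g r : ℕ) (P : V R g) → Fil R p g r P → (a : ℤ) →
               InPowV R p g r (act R g P (mat (+ 1) a (+ 0) (+ p)))
  fil-to-pʳV g r P fil a j =
    witness (act-bounded g P (mat (+ 1) a (+ 0) (+ p)) term-bound j)
    where
      powers : ∀ i → Bounded (λ _ → i) (powP R (linear₁ (+ 0) (+ p)) i)
      powers = bound-powP (λ i _ → i) ≡.refl (λ i n m → ℕ.≤-refl)
                 (linear₁-divisible (+ 0) (+ p) (p ∣0) ∣-refl)
      term-bound : ∀ i → Bounded (λ _ → r) (actTerm g P (mat (+ 1) a (+ 0) (+ p)) i)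
      term-bound i = bound-weaken (λ _ → ≤-∸-+ r (toℕ i))
        (term-bounded (+ 1) a (+ 0) (+ p) (λ i _ → i) fil (λ i n m → ℕ.≤-refl) powers i)

lemma6p4 : ∀ {c ℓ : Level} (R : CommutativeRing c ℓ) (p : ℕ) → Prime p → p ≢ 2 →
    (g r : ℕ) →
    ((P : V R g) (γ : M2) → InS₀ p γ → Fil R p g r P → Fil R p g r (act R g P γ))
    × ((P : V R g) → Fil R p g r P → (a : ℤ) → InPowV R p g r (act R g P (mat (+ 1) a (+ 0) (+ p))))
lemma6p4 R p _ _ g r = fil-stable R p g r , fil-to-pʳV R p g r
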